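{- Let $G$ be a finite simple graph with maximum degree $\Delta \ge 2$, and let $k$ be an integer with $\Delta \le k \le \Delta+1$. Then $\iota_k(G) \le ir(G)$.
   Context: For a vertex set $D$, $N_G[D]$ is the closed neighborhood of $D$ (the vertices of $D$ together with all their neighbors). A set $D \subseteq V(G)$ is $K_k$-isolating if $G - N_G[D]$ contains no clique on $k$ vertices; $\iota_k(G)$ is the minimum cardinality of a $K_k$-isolating set. For $S \subseteq V(G)$ and $x \in S$, the private neighborhood of $x$ with respect to $S$ is $PN(x,S) = N_G[x] \setminus N_G[S \setminus \{x\}]$. A set $I$ is irredundant if $PN(x,I) \neq \emptyset$ for every $x \in I$; it is maximal irredundant if no proper superset of it is irredundant. $ir(G)$ is the minimum cardinality of a maximal irredundant set of $G$. -}

module Defs where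

open import Data.Nat using (ℕ; _≤_)
open import Data.Fin using (Fin)
open import Data.Fin.Subset using (Subset; _∈_; _∉_; _⊂_; ∣_∣)
open import Data.Bool using (Bool; true; false)
open import Data.Vec using (tabulate)
open import Data.Product using (Σ; ∃; ∃-syntax; _×_)
open import Data.Sum using (_⊎_)
open import Relation.Nullary using (¬_)
open import Relation.Binary.PropositionalEquality using (_≡_; _≢_)

record Graph (n : ℕ) : Set where
  field
    adj     : Fin n → Fin n → Bool
    sym     : ∀ u v → adj u v ≡ adj v u
    irrefl  : ∀ v → adj v v ≡ false

module _ {n : ℕ} (G : Graph n) where
  open Graph G

  Adj : Fin n → Fin n → Set
  Adj u v = adj u v ≡ true

  N : Fin n → Subset n
  N v = tabulate (adj v)

  degree : Fin n → ℕ
  degree v = ∣ N v ∣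

  IsMaxDegree : ℕ → Set
  IsMaxDegree Δ = (∀ v → degree v ≤ Δ) × (∃[ v ] degree v ≡ Δ)

  InClosedNbhd : Subset n → Fin n → Set
  InClosedNbhd D u = ∃[ x ] (x ∈ D × (x ≡ u ⊎ Adj x u))

  InClosedNbhdV : Fin n → Fin n → Set
  InClosedNbhdV x u = x ≡ u ⊎ Adj x u

  IsKkCliqueAvoiding : ℕ → Subset n → Subset n → Set
  IsKkCliqueAvoiding k D C =
    ∣ C ∣ ≡ k
    × (∀ u → u ∈ C → ¬ InClosedNbhd D u)
    × (∀ u v → u ∈ C → v ∈ C → u ≢ v → Adj u v)

  IsKkIsolating : ℕ → Subset n → Set
  IsKkIsolating k D = ¬ (∃[ C ] IsKkCliqueAvoiding k D C)

  InClosedNbhdMinus : Subset n → Fin n → Fin n → Set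
  InClosedNbhdMinus S x u = ∃[ y ] (y ∈ S × y ≢ x × (y ≡ u ⊎ Adj y u))

  InPrivateNbhd : Subset n → Fin n → Fin n → Set
  InPrivateNbhd S x u = InClosedNbhdV x u × ¬ InClosedNbhdMinus S x u

  IsIrredundant : Subset n → Set
  IsIrredundant I = ∀ x → x ∈ I → ∃[ u ] InPrivateNbhd I x u

  IsMaximalIrredundant : Subset n → Set
  IsMaximalIrredundant I = IsIrredundant I × (∀ J → I ⊂ J → ¬ IsIrredundant J)

  IsMinCard : (Subset n → Set) → ℕ → Set
  IsMinCard P m = (∃[ S ] (P S × ∣ S ∣ ≡ m)) × (∀ S → P S → m ≤ ∣ S ∣)

  IsIota : ℕ → ℕ → Set
  IsIota k m = IsMinCard (IsKkIsolating k) m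

  IsIr : ℕ → Set
  IsIr m = IsMinCard IsMaximalIrredundant m

module Submission where

-- Let I be a maximal irredundant set of minimum size, and replace every x ∈ I
-- that has exactly one private neighbour by that neighbour.  The resulting set
-- D has at most |I| elements, and N[D] contains I together with every private
-- neighbour of a vertex of I.  Suppose a k-clique K avoids N[D] and u ∈ K.
-- Since u has k − 1 neighbours in K and degree at most Δ ≤ k, it has at most
-- one neighbour outside K.  If some x ∈ I dominates u, then u is not a private
-- neighbour of x, so a second vertex of I dominates u; both lie outside K, a
-- contradiction.  Otherwise every x ∈ I keeps a private neighbour outside N[u]
-- (a unique one lies in D, and of two private neighbours at most one is
-- adjacent to u), so I ∪ {u} is irredundant, contradicting maximality.

open import Defs
open import Data.Nat using (ℕ; suc; _≤_; _<_; _+_; z≤n; s≤s)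
open import Data.Nat.Properties
  using (≤-trans; ≤-reflexive; +-monoʳ-≤; +-suc; <⇒≱; module ≤-Reasoning)
open import Data.Fin using (Fin; _≟_) renaming (zero to fzero; suc to fsuc)
open import Data.Fin.Properties using (any?; all?; ¬∀⟶∃¬)
open import Data.Fin.Subset
  using (Subset; _∈_; _∉_; _⊆_; _⊂_; _-_; ⁅_⁆; _∪_; ⊥; ∣_∣; Nonempty)
open import Data.Fin.Subset.Properties
open import Data.Bool using (true; false)
open import Data.Bool.Properties using () renaming (_≟_ to _≟ᵇ_)
open import Data.Vec using (_∷_; []; here; there)
open import Data.Vec.Properties using (lookup∘tabulate; lookup⇒[]=)
open import Data.Product using (∃-syntax; _×_; _,_; proj₁; proj₂)
open import Data.Sum using (_⊎_; inj₁; inj₂; [_,_])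
open import Function using (_∘_)
open import Relation.Nullary using (¬_; Dec; yes; no; ¬?; contradiction)
open import Relation.Nullary.Decidable using (_×-dec_; _⊎-dec_; _→-dec_)
open import Relation.Binary.PropositionalEquality
  using (_≡_; _≢_; refl; sym; trans; subst)

∣p∪q∣≤∣p∣+∣q∣ : ∀ {n} (p q : Subset n) → ∣ p ∪ q ∣ ≤ ∣ p ∣ + ∣ q ∣
∣p∪q∣≤∣p∣+∣q∣ []          []          = z≤n
∣p∪q∣≤∣p∣+∣q∣ (true ∷ p)  (s ∷ q)     =
  s≤s (≤-trans (∣p∪q∣≤∣p∣+∣q∣ p q) (+-monoʳ-≤ ∣ p ∣ (∣p∣≤∣x∷p∣ s q)))
∣p∪q∣≤∣p∣+∣q∣ (false ∷ p) (true ∷ q)  rewrite +-suc ∣ p ∣ ∣ q ∣ = s≤s (∣p∪q∣≤∣p∣+∣q∣ p q)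
∣p∪q∣≤∣p∣+∣q∣ (false ∷ p) (false ∷ q) = ∣p∪q∣≤∣p∣+∣q∣ p q

∣⁅x⁆∪p∣≤1+∣p∣ : ∀ {n} (x : Fin n) (p : Subset n) → ∣ ⁅ x ⁆ ∪ p ∣ ≤ suc ∣ p ∣
∣⁅x⁆∪p∣≤1+∣p∣ x p =
  subst (λ m → ∣ ⁅ x ⁆ ∪ p ∣ ≤ m + ∣ p ∣) (∣⁅x⁆∣≡1 x) (∣p∪q∣≤∣p∣+∣q∣ ⁅ x ⁆ p)

∣p∣>0⇒nonempty : ∀ {n} (p : Subset n) → 0 < ∣ p ∣ → Nonempty p
∣p∣>0⇒nonempty (true ∷ p)  _     = fzero , here
∣p∣>0⇒nonempty (false ∷ p) 0<∣p∣ with ∣p∣>0⇒nonempty p 0<∣p∣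
... | x , x∈p = fsuc x , there x∈p

image : ∀ {n m} → (Fin n → Fin m) → Subset n → Subset m
image f []          = ⊥
image f (true ∷ p)  = ⁅ f fzero ⁆ ∪ image (f ∘ fsuc) p
image f (false ∷ p) = image (f ∘ fsuc) p

∣image∣≤∣p∣ : ∀ {n m} (f : Fin n → Fin m) (p : Subset n) → ∣ image f p ∣ ≤ ∣ p ∣
∣image∣≤∣p∣ {m = m} f []  = ≤-reflexive (∣⊥∣≡0 m)
∣image∣≤∣p∣ f (true ∷ p)  = ≤-trans (∣⁅x⁆∪p∣≤1+∣p∣ (f fzero) _) (s≤s (∣image∣≤∣p∣ (f ∘ fsuc) p))
∣image∣≤∣p∣ f (false ∷ p) = ∣image∣≤∣p∣ (f ∘ fsuc) p

x∈p⇒fx∈image : ∀ {n m} (f : Fin n → Fin m) {p : Subset n} {x} → x ∈ p → f x ∈ image f p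
x∈p⇒fx∈image f {true ∷ p}  here        = x∈p∪q⁺ (inj₁ (x∈⁅x⁆ (f fzero)))
x∈p⇒fx∈image f {true ∷ p}  (there x∈p) =
  x∈p∪q⁺ {p = ⁅ f fzero ⁆} (inj₂ (x∈p⇒fx∈image (f ∘ fsuc) x∈p))
x∈p⇒fx∈image f {false ∷ p} (there x∈p) = x∈p⇒fx∈image (f ∘ fsuc) x∈p

module _ {n : ℕ} (G : Graph n) where
  open Graph G using (adj) renaming (sym to adj-sym)

  Adj-sym : ∀ {u v} → Adj G u v → Adj G v u
  Adj-sym {u} {v} uv = trans (adj-sym v u) uv

  Adj⇒∈N : ∀ {u v} → Adj G u v → v ∈ N G u
  Adj⇒∈N {u} {v} uv = lookup⇒[]= v (N G u) (trans (lookup∘tabulate (adj u) v) uv)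

  InClosedNbhdV-sym : ∀ {x u} → InClosedNbhdV G x u → InClosedNbhdV G u x
  InClosedNbhdV-sym (inj₁ x≡u) = inj₁ (sym x≡u)
  InClosedNbhdV-sym (inj₂ xu)  = inj₂ (Adj-sym xu)

  InClosedNbhdV⇒Adj : ∀ {x u} → InClosedNbhdV G x u → x ≢ u → Adj G x u
  InClosedNbhdV⇒Adj (inj₁ x≡u) x≢u = contradiction x≡u x≢u
  InClosedNbhdV⇒Adj (inj₂ xu)  _   = xu

  InClosedNbhdV? : ∀ x u → Dec (InClosedNbhdV G x u)
  InClosedNbhdV? x u = (x ≟ u) ⊎-dec (adj x u ≟ᵇ true)

  InClosedNbhdMinus? : ∀ S x u → Dec (InClosedNbhdMinus G S x u)
  InClosedNbhdMinus? S x u = any? (λ y → (y ∈? S) ×-dec ¬? (y ≟ x) ×-dec InClosedNbhdV? y u)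

  InPrivateNbhd? : ∀ S x u → Dec (InPrivateNbhd G S x u)
  InPrivateNbhd? S x u = InClosedNbhdV? x u ×-dec ¬? (InClosedNbhdMinus? S x u)

  IsClique : Subset n → Set
  IsClique K = ∀ u v → u ∈ K → v ∈ K → u ≢ v → Adj G u v

  OuterNeighbour : Subset n → Fin n → Fin n → Set
  OuterNeighbour K u a = Adj G u a × a ∉ K

  clique-degree : ∀ {K u a b} → IsClique K → u ∈ K → a ≢ b →
                  OuterNeighbour K u a → OuterNeighbour K u b → suc ∣ K ∣ ≤ degree G u
  clique-degree {K} {u} {a} {b} clique u∈K a≢b (ua , a∉K) (ub , b∉K) = begin
    suc ∣ K ∣                   ≤⟨ s≤s (≤-trans (p⊆q⇒∣p∣≤∣q∣ K⊆u∪Nu-a-b) (∣⁅x⁆∪p∣≤1+∣p∣ u _)) ⟩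
    suc (suc ∣ N G u - a - b ∣) ≤⟨ s≤s (x∈p⇒∣p-x∣<∣p∣ b∈Nu-a) ⟩
    suc ∣ N G u - a ∣           ≤⟨ x∈p⇒∣p-x∣<∣p∣ (Adj⇒∈N ua) ⟩
    ∣ N G u ∣                   ∎
    where
    open ≤-Reasoning
    b∈Nu-a : b ∈ N G u - a
    b∈Nu-a = x∈p∧x≢y⇒x∈p-y (Adj⇒∈N ub) (λ { refl → a≢b refl })
    K⊆u∪Nu-a-b : K ⊆ ⁅ u ⁆ ∪ (N G u - a - b)
    K⊆u∪Nu-a-b {v} v∈K with v ≟ u
    ... | yes refl = x∈p∪q⁺ (inj₁ (x∈⁅x⁆ v))
    ... | no  v≢u  = x∈p∪q⁺ (inj₂ (x∈p∧x≢y⇒x∈p-y (x∈p∧x≢y⇒x∈p-y v∈Nu (λ { refl → a∉K v∈K }))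
                                                     (λ { refl → b∉K v∈K })))
      where
      v∈Nu = Adj⇒∈N (clique u v u∈K v∈K (λ { refl → v≢u refl }))

  outerNeighbour-unique : ∀ {K u a b} → degree G u ≤ ∣ K ∣ → IsClique K → u ∈ K →
                          OuterNeighbour K u a → OuterNeighbour K u b → a ≡ b
  outerNeighbour-unique {a = a} {b} degree≤∣K∣ clique u∈K ua ub with a ≟ b
  ... | yes a≡b = a≡b
  ... | no  a≢b = contradiction degree≤∣K∣ (<⇒≱ (clique-degree clique u∈K a≢b ua ub))

  InClosedNbhdMinus-∪⁅u⁆ : ∀ {I u z p} → InClosedNbhdMinus G (I ∪ ⁅ u ⁆) z p →
                           InClosedNbhdMinus G I z p ⊎ (u ≢ z × InClosedNbhdV G u p)
  InClosedNbhdMinus-∪⁅u⁆ {I} {u} (y , y∈J , y≢z , yp) with x∈p∪q⁻ I ⁅ u ⁆ y∈J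
  ... | inj₁ y∈I  = inj₁ (y , y∈I , y≢z , yp)
  ... | inj₂ y∈⁅u⁆ with x∈⁅y⁆⇒x≡y u y∈⁅u⁆
  ...   | refl = inj₂ (y≢z , yp)

  irredundant-∪⁅u⁆ : ∀ {I u} → ¬ InClosedNbhd G I u →
                     (∀ z → z ∈ I → ∃[ p ] (InPrivateNbhd G I z p × ¬ InClosedNbhdV G u p)) →
                     IsIrredundant G (I ∪ ⁅ u ⁆)
  irredundant-∪⁅u⁆ {I} {u} u∉N[I] escape z z∈J with x∈p∪q⁻ I ⁅ u ⁆ z∈J
  ... | inj₁ z∈I with escape z z∈I
  ...   | p , (zp , p∉N[I-z]) , p∉N[u] =
    p , zp , [ p∉N[I-z] , p∉N[u] ∘ proj₂ ] ∘ InClosedNbhdMinus-∪⁅u⁆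
  irredundant-∪⁅u⁆ {I} {u} u∉N[I] escape z z∈J | inj₂ z∈⁅u⁆ with x∈⁅y⁆⇒x≡y u z∈⁅u⁆
  ... | refl = u , inj₁ refl ,
    [ (λ { (y , y∈I , _ , yu) → u∉N[I] (y , y∈I , yu) }) , (λ { (u≢u , _) → u≢u refl }) ]
    ∘ InClosedNbhdMinus-∪⁅u⁆

module PrivateRepresentatives {n : ℕ} (G : Graph n) (I : Subset n) (irr : IsIrredundant G I) where

  privateNbr : Fin n → Fin n
  privateNbr x with any? (InPrivateNbhd? G I x)
  ... | yes (u , _) = u
  ... | no  _       = x

  privateNbr-private : ∀ {x} → x ∈ I → InPrivateNbhd G I x (privateNbr x)
  privateNbr-private {x} x∈I with any? (InPrivateNbhd? G I x)
  ... | yes (_ , pn) = pn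
  ... | no  ¬pn      = contradiction (irr x x∈I) ¬pn

  HasUniquePrivateNbr : Fin n → Set
  HasUniquePrivateNbr x = ∀ u → InPrivateNbhd G I x u → u ≡ privateNbr x

  HasUniquePrivateNbr? : ∀ x → Dec (HasUniquePrivateNbr x)
  HasUniquePrivateNbr? x = all? (λ u → InPrivateNbhd? G I x u →-dec (u ≟ privateNbr x))

  ¬unique⇒secondPrivateNbr : ∀ {x} → ¬ HasUniquePrivateNbr x →
                             ∃[ p ] (InPrivateNbhd G I x p × p ≢ privateNbr x)
  ¬unique⇒secondPrivateNbr {x} ¬unique
    with ¬∀⟶∃¬ n _ (λ u → InPrivateNbhd? G I x u →-dec (u ≟ privateNbr x)) ¬unique
  ... | p , ¬[pn→p≡q] with InPrivateNbhd? G I x p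
  ...   | yes pn = p , pn , λ p≡q → ¬[pn→p≡q] (λ _ → p≡q)
  ...   | no ¬pn = contradiction (λ pn → contradiction pn ¬pn) ¬[pn→p≡q]

  representative : Fin n → Fin n
  representative x with HasUniquePrivateNbr? x
  ... | yes _ = privateNbr x
  ... | no  _ = x

  representatives : Subset n
  representatives = image representative I

  ∣representatives∣≤∣I∣ : ∣ representatives ∣ ≤ ∣ I ∣
  ∣representatives∣≤∣I∣ = ∣image∣≤∣p∣ representative I

  uniquePrivateNbr∈representatives : ∀ {x} → x ∈ I → HasUniquePrivateNbr x →
                                     privateNbr x ∈ representatives
  uniquePrivateNbr∈representatives {x} x∈I unique with HasUniquePrivateNbr? x
     | x∈p⇒fx∈image representative x∈I
  ... | yes _       | r∈D = r∈D
  ... | no ¬unique | _   = contradiction unique ¬unique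

  ¬unique⇒∈representatives : ∀ {x} → x ∈ I → ¬ HasUniquePrivateNbr x → x ∈ representatives
  ¬unique⇒∈representatives {x} x∈I ¬unique with HasUniquePrivateNbr? x
     | x∈p⇒fx∈image representative x∈I
  ... | yes unique | _   = contradiction unique ¬unique
  ... | no _       | r∈D = r∈D

  I⊆N[representatives] : ∀ {x} → x ∈ I → InClosedNbhd G representatives x
  I⊆N[representatives] {x} x∈I with HasUniquePrivateNbr? x
  ... | yes unique = privateNbr x , uniquePrivateNbr∈representatives x∈I unique ,
                     InClosedNbhdV-sym G (proj₁ (privateNbr-private x∈I))
  ... | no ¬unique = x , ¬unique⇒∈representatives x∈I ¬unique , inj₁ refl

  privateNbhd⊆N[representatives] : ∀ {x u} → x ∈ I → InPrivateNbhd G I x u →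
                                   InClosedNbhd G representatives u
  privateNbhd⊆N[representatives] {x} {u} x∈I pn with HasUniquePrivateNbr? x
  ... | yes unique = privateNbr x , uniquePrivateNbr∈representatives x∈I unique ,
                     inj₁ (sym (unique u pn))
  ... | no ¬unique = x , ¬unique⇒∈representatives x∈I ¬unique , proj₁ pn

module Isolation {n : ℕ} {G : Graph n} {I : Subset n} (maxIrr : IsMaximalIrredundant G I) where
  open PrivateRepresentatives G I (proj₁ maxIrr)

  module _ {K : Subset n} (degree≤∣K∣ : ∀ v → degree G v ≤ ∣ K ∣) (clique : IsClique G K)
           (K-avoids : ∀ u → u ∈ K → ¬ InClosedNbhd G representatives u) where

    I∩K≡∅ : ∀ {x} → x ∈ I → x ∉ K
    I∩K≡∅ x∈I x∈K = K-avoids _ x∈K (I⊆N[representatives] x∈I)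

    privateNbhd∩K≡∅ : ∀ {x p} → x ∈ I → InPrivateNbhd G I x p → p ∉ K
    privateNbhd∩K≡∅ x∈I pn p∈K = K-avoids _ p∈K (privateNbhd⊆N[representatives] x∈I pn)

    dominator-outer : ∀ {u x} → u ∈ K → x ∈ I → InClosedNbhdV G x u → OuterNeighbour G K u x
    dominator-outer u∈K x∈I xu =
      Adj-sym G (InClosedNbhdV⇒Adj G xu (λ { refl → I∩K≡∅ x∈I u∈K })) , I∩K≡∅ x∈I

    K∩N[I]≡∅ : ∀ {u} → u ∈ K → ¬ InClosedNbhd G I u
    K∩N[I]≡∅ {u} u∈K (x , x∈I , xu) with InClosedNbhdMinus? G I x u
    ... | no  u∉N[I-x] = K-avoids u u∈K (privateNbhd⊆N[representatives] x∈I (xu , u∉N[I-x]))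
    ... | yes (y , y∈I , y≢x , yu) =
      y≢x (outerNeighbour-unique G (degree≤∣K∣ u) clique u∈K
             (dominator-outer u∈K y∈I yu) (dominator-outer u∈K x∈I xu))

    module _ {u : Fin n} (u∈K : u ∈ K) (u∉N[I] : ¬ InClosedNbhd G I u) where

      privateNbr-outer : ∀ {z p} → z ∈ I → InPrivateNbhd G I z p → InClosedNbhdV G u p →
                         OuterNeighbour G K u p
      privateNbr-outer z∈I pn up =
        InClosedNbhdV⇒Adj G up (λ { refl → u∉N[I] (_ , z∈I , proj₁ pn) }) ,
        privateNbhd∩K≡∅ z∈I pn

      privateNbr-avoiding-N[u] : ∀ z → z ∈ I →
                                 ∃[ p ] (InPrivateNbhd G I z p × ¬ InClosedNbhdV G u p)
      privateNbr-avoiding-N[u] z z∈I with HasUniquePrivateNbr? z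
      ... | yes unique = privateNbr z , privateNbr-private z∈I , λ uq →
        K-avoids u u∈K (privateNbr z , uniquePrivateNbr∈representatives z∈I unique ,
                        InClosedNbhdV-sym G uq)
      ... | no ¬unique with ¬unique⇒secondPrivateNbr ¬unique
      ...   | p , pn , p≢q with InClosedNbhdV? G u (privateNbr z) | InClosedNbhdV? G u p
      ...     | no ¬uq | _      = privateNbr z , privateNbr-private z∈I , ¬uq
      ...     | yes _  | no ¬up = p , pn , ¬up
      ...     | yes uq | yes up = contradiction
        (outerNeighbour-unique G (degree≤∣K∣ u) clique u∈K
          (privateNbr-outer z∈I pn up) (privateNbr-outer z∈I (privateNbr-private z∈I) uq))
        p≢q

    K≡∅ : ∀ {u} → u ∉ K
    K≡∅ {u} u∈K = proj₂ maxIrr (I ∪ ⁅ u ⁆) I⊂I∪⁅u⁆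
      (irredundant-∪⁅u⁆ G u∉N[I] (privateNbr-avoiding-N[u] u∈K u∉N[I]))
      where
      u∉N[I] = K∩N[I]≡∅ u∈K
      I⊂I∪⁅u⁆ : I ⊂ I ∪ ⁅ u ⁆
      I⊂I∪⁅u⁆ = p⊆p∪q ⁅ u ⁆ , u , x∈p∪q⁺ (inj₂ (x∈⁅x⁆ u)) , λ u∈I → u∉N[I] (u , u∈I , inj₁ refl)

  representatives-isolating : ∀ {k} → (∀ v → degree G v ≤ k) → 0 < k →
                              IsKkIsolating G k representatives
  representatives-isolating degree≤k 0<k (K , refl , K-avoids , clique)
    with ∣p∣>0⇒nonempty K 0<k
  ... | _ , u∈K = K≡∅ degree≤k clique K-avoids u∈K

theorem3 : (n : ℕ) (G : Graph n) (Δ k : ℕ) → IsMaxDegree G Δ → 2 ≤ Δ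
    → Δ ≤ k → k ≤ Δ + 1
    → (ι ir : ℕ) → IsIota G k ι → IsIr G ir → ι ≤ ir
-- Only Δ ≤ k (which also gives k > 0) is used.
theorem3 n G Δ k (degree≤Δ , _) 2≤Δ Δ≤k _ ι ir (_ , ι-minimal) ((I , maxIrr , ∣I∣≡ir) , _) = begin
  ι                   ≤⟨ ι-minimal representatives (representatives-isolating degree≤k 0<k) ⟩
  ∣ representatives ∣ ≤⟨ ∣representatives∣≤∣I∣ ⟩
  ∣ I ∣               ≡⟨ ∣I∣≡ir ⟩
  ir                  ∎
  where
  open ≤-Reasoning
  open PrivateRepresentatives G I (proj₁ maxIrr)
  open Isolation maxIrr
  degree≤k : ∀ v → degree G v ≤ k
  degree≤k v = ≤-trans (degree≤Δ v) Δ≤k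
  0<k : 0 < k
  0<k = ≤-trans (s≤s z≤n) (≤-trans 2≤Δ Δ≤k)
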